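{- The bijection $\phi$ from triangulations of $P^\square_\varepsilon$ to $\varepsilon$-trees, induced by $\phi\big((i_\square,j_\square)\big)=(i_\bullet,j_\circ)$ for $0\le i<j\le n+1$, preserves increasing flips: there is an increasing flip from $T$ to $T'$ if and only if there is an increasing flip from $\phi(T)$ to $\phi(T')$. Consequently, the reflexive-transitive closure of the increasing flip graph on $\varepsilon$-trees is isomorphic to the $\varepsilon$-Cambrian lattice.
   Context: Fix an integer $n\ge 1$ and $\varepsilon\in\{+,-\}^n$. Let $P^\square_\varepsilon$ be a convex $(n+2)$-gon with vertices $0_\square,\dots,(n+1)_\square$ in strictly increasing $x$-order, with $k_\square$ strictly above the segment $[0_\square,(n+1)_\square]$ if $\varepsilon_k=+$ and strictly below if $\varepsilon_k=-$. A triangulation of $P^\square_\varepsilon$ is an inclusion-maximal set of pairwise non-crossing segments $(i_\square,j_\square)$, $0\le i<j\le n+1$ (boundary edges included; segments cross if they meet at a point interior to both). Two triangulations $T,T'$ are related by an increasing flip from $T$ to $T'$ if $T\setminus\{\delta\}=T'\setminus\{\delta'\}$ with $\delta\ne\delta'$ and the slope of $\delta$ smaller than the slope of $\delta'$. The $\varepsilon$-Cambrian lattice (of N. Reading) is the reflexive-transitive closure of the increasing flip relation on triangulations of $P^\square_\varepsilon$. Black vertices are $0_\bullet,\dots,n_\bullet$, white vertices $1_\circ,\dots,(n+1)_\circ$. Let $P_\varepsilon$ be a convex $(2n+2)$-gon whose vertices, in strictly increasing $x$-order, are $0_\bullet,1_\circ,1_\bullet,\dots,n_\circ,n_\bullet,(n+1)_\circ$,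 with $k_\circ,k_\bullet$ strictly above the line through $0_\bullet$ and $(n+1)_\circ$ if $\varepsilon_k=+$ and strictly below if $\varepsilon_k=-$. Let $G_\varepsilon$ be the geometric graph on these vertices with a straight edge $(i_\bullet,j_\circ)$ whenever $i<j$. An $\varepsilon$-tree is an inclusion-maximal set of pairwise non-crossing edges of $G_\varepsilon$ ($\phi$ maps triangulations bijectively onto $\varepsilon$-trees). There is an increasing flip from an $\varepsilon$-tree $S$ to $S'$ if $S\setminus\{e\}=S'\setminus\{e'\}$, $e\ne e'$, and the slope of $e$ is smaller than the slope of $e'$.
   Formalization: The vertices of the polygons $P^\square_\varepsilon$ and $P_\varepsilon$ have rational coordinates. -}

module Defs where

open import Data.Nat as ℕ using (ℕ; zero; suc; _*_; _∸_; _≡ᵇ_)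
open import Data.Fin using (Fin; fromℕ<)
open import Data.Rational as ℚ using (ℚ; 0ℚ)
open import Data.Product using (Σ; _×_; _,_; proj₁; proj₂; ∃)
open import Data.Sum using (_⊎_)
open import Data.Bool using (Bool; true; false; _∧_; not)
open import Relation.Binary.PropositionalEquality using (_≡_; _≢_)
open import Relation.Nullary using (¬_)
open import Relation.Binary.Construct.Closure.ReflexiveTransitive using (Star)

Point : Set
Point = ℚ × ℚ

xc : Point → ℚ
xc = proj₁

yc : Point → ℚ
yc = proj₂

-- orientation determinant: > 0 iff (a,b,c) is counter-clockwise,
-- i.e. c lies strictly to the left of (= above, when x a < x b) the
-- directed line a → b
orient : Point → Point → Point → ℚ
orient a b c = ℚ._-_ (ℚ._*_ (ℚ._-_ (xc b) (xc a)) (ℚ._-_ (yc c) (yc a)))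
                     (ℚ._*_ (ℚ._-_ (yc b) (yc a)) (ℚ._-_ (xc c) (xc a)))

InTriangle : Point → Point → Point → Point → Set
InTriangle a b c d =
  (ℚ._≤_ 0ℚ (orient a b d) × ℚ._≤_ 0ℚ (orient b c d) × ℚ._≤_ 0ℚ (orient c a d))
  ⊎ (ℚ._≤_ (orient a b d) 0ℚ × ℚ._≤_ (orient b c d) 0ℚ × ℚ._≤_ (orient c a d) 0ℚ)

ConvexPosition : ℕ → (ℕ → Point) → Set
ConvexPosition N q =
  (∀ i j → i ℕ.< N → j ℕ.< N → i ≢ j → q i ≢ q j)
  × (∀ i j k → i ℕ.< N → j ℕ.< N → k ℕ.< N → i ≢ j → j ≢ k → i ≢ k →
       orient (q i) (q j) (q k) ≢ 0ℚ)
  × (∀ i j k l → i ℕ.< N → j ℕ.< N → k ℕ.< N → l ℕ.< N →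
       i ≢ j → i ≢ k → i ≢ l → j ≢ k → j ≢ l → k ≢ l →
       ¬ InTriangle (q i) (q j) (q k) (q l))

XIncreasing : ℕ → (ℕ → Point) → Set
XIncreasing N q = ∀ i j → i ℕ.< N → j ℕ.< N → i ℕ.< j → ℚ._<_ (xc (q i)) (xc (q j))

data Sign : Set where
  plus minus : Sign

-- v = orient (left end) (right end) point; plus: strictly above, minus: strictly below
SideOK : Sign → ℚ → Set
SideOK plus  v = ℚ._<_ 0ℚ v
SideOK minus v = ℚ._<_ v 0ℚ

-- P^□_ε : vertex k_□ is p k, for 0 ≤ k ≤ n+1
IsSquarePolygon : (n : ℕ) → (Fin n → Sign) → (ℕ → Point) → Set
IsSquarePolygon n ε p =
  XIncreasing (suc (suc n)) p
  × ConvexPosition (suc (suc n)) p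
  × (∀ k → (k<n : k ℕ.< n) →
       SideOK (ε (fromℕ< k<n)) (orient (p 0) (p (suc n)) (p (suc k))))

-- P_ε : vertices in x-order 0•,1∘,1•,…,n∘,n•,(n+1)∘ are q 0, q 1, …, q (2n+1);
-- so k• = q (2k) and k∘ = q (2k-1).
black : (ℕ → Point) → ℕ → Point
black q i = q (2 * i)

white : (ℕ → Point) → ℕ → Point
white q j = q (2 * j ∸ 1)

IsBlackWhitePolygon : (n : ℕ) → (Fin n → Sign) → (ℕ → Point) → Set
IsBlackWhitePolygon n ε q =
  XIncreasing (suc (suc (2 * n))) q
  × ConvexPosition (suc (suc (2 * n))) q
  × (∀ k → (k<n : k ℕ.< n) →
       SideOK (ε (fromℕ< k<n)) (orient (black q 0) (white q (suc n)) (white q (suc k)))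
       × SideOK (ε (fromℕ< k<n)) (orient (black q 0) (white q (suc n)) (black q (suc k))))

-- A segment is indexed by a pair (i , j) with 0 ≤ i < j ≤ n+1; it joins
-- the point L i to the point R j.  For P^□_ε : L = R = p (segment (i□,j□));
-- for G_ε : L = black q, R = white q (edge (i•,j∘)).

-- closed segments [a,b] and [c,d] cross (meet at a point interior to both).
-- Since all vertices are in general position (no three collinear), this is
-- exactly strict mutual straddling.
Cross : Point → Point → Point → Point → Set
Cross a b c d =
  ℚ._<_ (ℚ._*_ (orient a b c) (orient a b d)) 0ℚ
  × ℚ._<_ (ℚ._*_ (orient c d a) (orient c d b)) 0ℚ

EdgeSet : Set
EdgeSet = ℕ → ℕ → Bool

WellFormed : ℕ → EdgeSet → Set
WellFormed n S = ∀ i j → S i j ≡ true → i ℕ.< j × j ℕ.≤ suc n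

_⊆_ : EdgeSet → EdgeSet → Set
S ⊆ S' = ∀ i j → S i j ≡ true → S' i j ≡ true

NonCrossing : (L R : ℕ → Point) → EdgeSet → Set
NonCrossing L R S = ∀ i j k l → S i j ≡ true → S k l ≡ true →
  ¬ Cross (L i) (R j) (L k) (R l)

MaxNonCrossing : ℕ → (L R : ℕ → Point) → EdgeSet → Set
MaxNonCrossing n L R S =
  WellFormed n S × NonCrossing L R S
  × (∀ S' → WellFormed n S' → NonCrossing L R S' → S ⊆ S' → S' ⊆ S)

IsTriangulation : ℕ → (ℕ → Point) → EdgeSet → Set
IsTriangulation n p T = MaxNonCrossing n p p T

IsEpsTree : ℕ → (ℕ → Point) → EdgeSet → Set
IsEpsTree n q S = MaxNonCrossing n (black q) (white q) S

remove : EdgeSet → ℕ → ℕ → EdgeSet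
remove S a b i j = S i j ∧ not ((i ≡ᵇ a) ∧ (j ≡ᵇ b))

-- slope of segment [a,b] < slope of [c,d]  (x a < x b, x c < x d, so the
-- slopes' comparison is this cross-multiplied inequality)
SlopeLt : Point → Point → Point → Point → Set
SlopeLt a b c d =
  ℚ._<_ (ℚ._*_ (ℚ._-_ (yc b) (yc a)) (ℚ._-_ (xc d) (xc c)))
        (ℚ._*_ (ℚ._-_ (yc d) (yc c)) (ℚ._-_ (xc b) (xc a)))

IncFlip : ℕ → (L R : ℕ → Point) → EdgeSet → EdgeSet → Set
IncFlip n L R S S' =
  MaxNonCrossing n L R S × MaxNonCrossing n L R S'
  × Σ ℕ λ a → Σ ℕ λ b → Σ ℕ λ c → Σ ℕ λ d →
      S a b ≡ true × S' c d ≡ true × ¬ (a ≡ c × b ≡ d)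
      × (∀ i j → remove S a b i j ≡ remove S' c d i j)
      × SlopeLt (L a) (R b) (L c) (R d)

IncFlipTri : ℕ → (ℕ → Point) → EdgeSet → EdgeSet → Set
IncFlipTri n p = IncFlip n p p

IncFlipTree : ℕ → (ℕ → Point) → EdgeSet → EdgeSet → Set
IncFlipTree n q = IncFlip n (black q) (white q)

CambrianLe : ℕ → (ℕ → Point) → EdgeSet → EdgeSet → Set
CambrianLe n p = Star (IncFlipTri n p)

TreeLe : ℕ → (ℕ → Point) → EdgeSet → EdgeSet → Set
TreeLe n q = Star (IncFlipTree n q)

-- φ((i□ , j□)) = (i• , j∘): in the index-pair encoding, φ acts as the
-- identity on the characteristic function.
φ : EdgeSet → EdgeSet
φ T = T

-- All orientations that matter are determined by combinatorics. In a convex polygon whose vertices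
-- are sorted by x-coordinate, the orientation of three vertices a < b < c is the side of the chord
-- from the first to the last vertex on which the middle vertex b lies; for an arbitrary triple it
-- is that side times the sign of the sorting permutation. Sending i□ to i• and j□ to j∘ preserves
-- both the relative order of the vertices and these sides, so corresponding triples of P^□_ε and
-- P_ε have equal orientation signs. Crossing of two segments is a condition on four such signs, so
-- non-crossing sets, and hence triangulations and ε-trees, correspond. The two diagonals exchanged
-- by a flip cross (otherwise maximality would be violated), and for crossing segments [a,b], [c,d]
-- the slope of [a,b] is smaller than that of [c,d] iff d lies to the left of a → b, again a sign
-- condition; so increasing flips correspond as well.
module Submission where

open import Defs
open import Data.Nat using (ℕ; _≥_)
open import Data.Fin using (Fin)
open import Data.Product using (_×_)
open import Function.Bundles using (_⇔_)

open import Data.Nat as ℕ using (zero; suc; z≤n; s≤s; _∸_; ⌈_/2⌉)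
import Data.Nat.Properties as ℕₚ
open import Data.Fin using (fromℕ<)
open import Data.Rational using (ℚ; 0ℚ; _<_; _+_; _*_; -_; _-_; positive; negative)
open import Data.Rational.Properties
  using (<-irrefl; <-asym; *-zeroˡ; *-zeroʳ; +-identityˡ; +-inverseʳ; +-monoˡ-<; neg-antimono-<;
         positive⁻¹; negative⁻¹; pos*pos⇒pos; pos*neg⇒neg; neg*pos⇒neg; neg*neg⇒pos;
         pos+pos⇒pos; neg+neg⇒neg; <⇒≤; <-cmp; _<?_)
open import Data.Rational.Solver using (module +-*-Solver)
open import Data.Product using (Σ; _,_; proj₁; proj₂)
open import Data.Sum using (_⊎_; inj₁; inj₂)
open import Data.Bool using (true; false; _∧_; _∨_)
open import Data.Bool.Properties using (∧-zeroʳ; ∨-zeroʳ; T-≡)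
open import Data.Empty using (⊥-elim)
open import Relation.Binary.PropositionalEquality
open import Relation.Binary.Definitions using (tri<; tri≈; tri>)
open import Relation.Nullary using (¬_; Dec; yes; no)
open import Function.Bundles using (mk⇔; Equivalence)
import Function.Properties.Equivalence as ⇔
import Relation.Binary.Construct.Closure.ReflexiveTransitive as Star

opposite : Sign → Sign
opposite plus  = minus
opposite minus = plus

infixl 7 _·_
_·_ : Sign → Sign → Sign
plus  · t = t
minus · t = opposite t

·-identityʳ : ∀ s → s · plus ≡ s
·-identityʳ plus  = refl
·-identityʳ minus = refl

·-opposite : ∀ s → s · opposite s ≡ minus
·-opposite plus  = refl
·-opposite minus = refl

·≡minus⇒opposite : ∀ s t → s · t ≡ minus → t ≡ opposite s
·≡minus⇒opposite plus  minus _ = refl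
·≡minus⇒opposite minus plus  _ = refl

SideOK-unique : ∀ {s t u} → SideOK s u → SideOK t u → s ≡ t
SideOK-unique {plus}  {plus}  _ _ = refl
SideOK-unique {plus}  {minus} h k = ⊥-elim (<-asym h k)
SideOK-unique {minus} {plus}  h k = ⊥-elim (<-asym h k)
SideOK-unique {minus} {minus} _ _ = refl

SideOK-transport : ∀ {s t u v} → SideOK s u → SideOK s v → SideOK t u → SideOK t v
SideOK-transport {s} {t} {v = v} hu hv ht = subst (λ r → SideOK r v) (SideOK-unique hu ht) hv

SideOK⇒≢0 : ∀ {s u} → SideOK s u → u ≢ 0ℚ
SideOK⇒≢0 {plus}  h refl = <-irrefl refl h
SideOK⇒≢0 {minus} h refl = <-irrefl refl h

sign : ∀ u → u ≢ 0ℚ → Σ Sign λ s → SideOK s u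
sign u u≢0 with <-cmp u 0ℚ
... | tri< u<0 _ _ = minus , u<0
... | tri≈ _ u≡0 _ = ⊥-elim (u≢0 u≡0)
... | tri> _ _ u>0 = plus , u>0

SideOK-neg : ∀ {s u} → SideOK s u → SideOK (opposite s) (- u)
SideOK-neg {plus}  = neg-antimono-<
SideOK-neg {minus} = neg-antimono-<

SideOK-neg′ : ∀ {s u} → SideOK (opposite s) u → SideOK s (- u)
SideOK-neg′ {plus}  = neg-antimono-<
SideOK-neg′ {minus} = neg-antimono-<

SideOK-* : ∀ {s t u v} → SideOK s u → SideOK t v → SideOK (s · t) (u * v)
SideOK-* {plus}  {plus}  {u} {v} h k = positive⁻¹ _ {{pos*pos⇒pos u {{positive h}} v {{positive k}}}}
SideOK-* {plus}  {minus} {u} {v} h k = negative⁻¹ _ {{pos*neg⇒neg u {{positive h}} v {{negative k}}}}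
SideOK-* {minus} {plus}  {u} {v} h k = negative⁻¹ _ {{neg*pos⇒neg u {{negative h}} v {{positive k}}}}
SideOK-* {minus} {minus} {u} {v} h k = positive⁻¹ _ {{neg*neg⇒pos u {{negative h}} v {{negative k}}}}

SideOK-+ : ∀ {s u v} → SideOK s u → SideOK s v → SideOK s (u + v)
SideOK-+ {plus}  {u} {v} h k = positive⁻¹ _ {{pos+pos⇒pos u {{positive h}} v {{positive k}}}}
SideOK-+ {minus} {u} {v} h k = negative⁻¹ _ {{neg+neg⇒neg u {{negative h}} v {{negative k}}}}

SideOK-- : ∀ {s u v} → SideOK s u → SideOK (opposite s) v → SideOK s (u - v)
SideOK-- h k = SideOK-+ h (SideOK-neg′ k)

SideOK-*-pos : ∀ {s u v} → SideOK s u → 0ℚ < v → SideOK s (u * v)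
SideOK-*-pos {s} {u} {v} h v>0 = subst (λ t → SideOK t (u * v)) (·-identityʳ s) (SideOK-* h v>0)

SideOK-cancel-pos : ∀ {s u v} → SideOK s (u * v) → 0ℚ < v → SideOK s u
SideOK-cancel-pos {s} {u} {v} h v>0 with sign u (λ { refl → SideOK⇒≢0 h (*-zeroˡ v) })
... | t , hu = subst (λ r → SideOK r u) (SideOK-unique (SideOK-*-pos hu v>0) h) hu

SideOK-dichotomy : ∀ s {u} → u ≢ 0ℚ → SideOK s u ⊎ SideOK (opposite s) u
SideOK-dichotomy s {u} u≢0 with sign u u≢0
SideOK-dichotomy plus  _ | plus  , h = inj₁ h
SideOK-dichotomy plus  _ | minus , h = inj₂ h
SideOK-dichotomy minus _ | plus  , h = inj₂ h
SideOK-dichotomy minus _ | minus , h = inj₁ h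

*-neg⇒opposite : ∀ {s t u v} → SideOK s u → SideOK t v → u * v < 0ℚ → t ≡ opposite s
*-neg⇒opposite {s} {t} hu hv uv<0 = ·≡minus⇒opposite s t (SideOK-unique (SideOK-* hu hv) uv<0)

opposite⇒*-neg : ∀ {s u v} → SideOK s u → SideOK (opposite s) v → u * v < 0ℚ
opposite⇒*-neg {s} {u} {v} hu hv = subst (λ t → SideOK t (u * v)) (·-opposite s) (SideOK-* hu hv)

same-side⇒¬*-neg : ∀ {s u v} → SideOK s u → SideOK s v → ¬ (u * v < 0ℚ)
same-side⇒¬*-neg {s} hu hv uv<0 = opposite-≢ s (sym (*-neg⇒opposite hu hv uv<0))
  where
  opposite-≢ : ∀ s → opposite s ≢ s
  opposite-≢ plus  ()
  opposite-≢ minus ()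

*-neg⇒≢0ˡ : ∀ {u v} → u * v < 0ℚ → u ≢ 0ℚ
*-neg⇒≢0ˡ {v = v} uv<0 refl = <-irrefl (*-zeroˡ v) uv<0

*-neg⇒≢0ʳ : ∀ {u v} → u * v < 0ℚ → v ≢ 0ℚ
*-neg⇒≢0ʳ {u} uv<0 refl = <-irrefl (*-zeroʳ u) uv<0

SameSign : ℚ → ℚ → Set
SameSign u v = Σ Sign λ s → SideOK s u × SideOK s v

SameSign-sym : ∀ {u v} → SameSign u v → SameSign v u
SameSign-sym (s , hu , hv) = s , hv , hu

SameSign-pos⇔ : ∀ {u v} → SameSign u v → 0ℚ < u ⇔ 0ℚ < v
SameSign-pos⇔ (_ , hu , hv) = mk⇔ (SideOK-transport {t = plus} hu hv) (SideOK-transport {t = plus} hv hu)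

SameSign-*-neg : ∀ {u u′ v v′} → SameSign u u′ → SameSign v v′ → u * v < 0ℚ → u′ * v′ < 0ℚ
SameSign-*-neg (s , hu , hu′) (t , hv , hv′) uv<0 with *-neg⇒opposite hu hv uv<0
... | refl = opposite⇒*-neg hu′ hv′

<⇔0<- : ∀ {u v} → u < v ⇔ 0ℚ < v - u
<⇔0<- {u} {v} = mk⇔
  (λ u<v → subst (_< v - u) (+-inverseʳ u) (+-monoˡ-< (- u) u<v))
  (λ 0<v-u → subst₂ _<_ (+-identityˡ u) (solve 2 (λ u v → (v :- u) :+ u := v) refl u v)
                     (+-monoˡ-< u 0<v-u))
  where open +-*-Solver

module _ where
  open +-*-Solver

  private
    O : ∀ {m} → (ax ay bx by cx cy : Polynomial m) → Polynomial m
    O ax ay bx by cx cy = ((bx :- ax) :* (cy :- ay)) :- ((by :- ay) :* (cx :- ax))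

  orient-cycle : ∀ a b c → orient a b c ≡ orient b c a
  orient-cycle (ax , ay) (bx , by) (cx , cy) = solve 6 (λ ax ay bx by cx cy →
    O ax ay bx by cx cy := O bx by cx cy ax ay) refl ax ay bx by cx cy

  orient-swap : ∀ a b c → orient a b c ≡ - orient a c b
  orient-swap (ax , ay) (bx , by) (cx , cy) = solve 6 (λ ax ay bx by cx cy →
    O ax ay bx by cx cy := :- O ax ay cx cy bx by) refl ax ay bx by cx cy

  orient-aba : ∀ a b → orient a b a ≡ 0ℚ
  orient-aba (ax , ay) (bx , by) = solve 4 (λ ax ay bx by →
    O ax ay bx by ax ay := con 0ℚ) refl ax ay bx by

  orient-abb : ∀ a b → orient a b b ≡ 0ℚ
  orient-abb (ax , ay) (bx , by) = solve 4 (λ ax ay bx by →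
    O ax ay bx by bx by := con 0ℚ) refl ax ay bx by

  -- Three-term Grassmann–Plücker relations among four points, with the x-coordinate as the
  -- affine weight.
  orient-relation₁ : ∀ w x y z →
    orient x y z * (xc x - xc w) ≡ orient w x z * (xc y - xc x) - orient w x y * (xc z - xc x)
  orient-relation₁ (x1 , y1) (x2 , y2) (x3 , y3) (x4 , y4) = solve 8 (λ x1 y1 x2 y2 x3 y3 x4 y4 →
    O x2 y2 x3 y3 x4 y4 :* (x2 :- x1) := O x1 y1 x2 y2 x4 y4 :* (x3 :- x2) :- O x1 y1 x2 y2 x3 y3 :* (x4 :- x2))
    refl x1 y1 x2 y2 x3 y3 x4 y4

  orient-relation₂ : ∀ w x y z →
    orient w x y * (xc z - xc y) ≡ orient w y z * (xc y - xc x) - orient x y z * (xc y - xc w)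
  orient-relation₂ (x1 , y1) (x2 , y2) (x3 , y3) (x4 , y4) = solve 8 (λ x1 y1 x2 y2 x3 y3 x4 y4 →
    O x1 y1 x2 y2 x3 y3 :* (x4 :- x3) := O x1 y1 x3 y3 x4 y4 :* (x3 :- x2) :- O x2 y2 x3 y3 x4 y4 :* (x3 :- x1))
    refl x1 y1 x2 y2 x3 y3 x4 y4

  slope-difference : ∀ a b c d →
    (yc d - yc c) * (xc b - xc a) - (yc b - yc a) * (xc d - xc c) ≡ orient a b d - orient a b c
  slope-difference (ax , ay) (bx , by) (cx , cy) (dx , dy) = solve 8 (λ ax ay bx by cx cy dx dy →
    (dy :- cy) :* (bx :- ax) :- (by :- ay) :* (dx :- cx) := O ax ay bx by dx dy :- O ax ay bx by cx cy)
    refl ax ay bx by cx cy dx dy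

Cross-sym : ∀ {a b c d} → Cross a b c d → Cross c d a b
Cross-sym (abc , cda) = cda , abc

Cross⇒distinct : ∀ {a b c d} → Cross a b c d → a ≢ c × b ≢ d × b ≢ c × a ≢ d
Cross⇒distinct {a} {b} {c} {d} (abcd , cdab) =
  (λ { refl → *-neg⇒≢0ˡ {v = orient a b d} abcd (orient-aba a b) }) ,
  (λ { refl → *-neg⇒≢0ʳ {orient c b a} cdab (orient-abb c b) }) ,
  (λ { refl → *-neg⇒≢0ˡ {v = orient a b d} abcd (orient-abb a b) }) ,
  (λ { refl → *-neg⇒≢0ˡ {v = orient c d b} cdab (orient-abb c a) })

Cross-transfer : ∀ {a b c d a′ b′ c′ d′} →
  SameSign (orient a b c) (orient a′ b′ c′) → SameSign (orient a b d) (orient a′ b′ d′) →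
  SameSign (orient c d a) (orient c′ d′ a′) → SameSign (orient c d b) (orient c′ d′ b′) →
  Cross a b c d → Cross a′ b′ c′ d′
Cross-transfer abc abd cda cdb (abcd , cdab) = SameSign-*-neg abc abd abcd , SameSign-*-neg cda cdb cdab

SlopeLt⇔ : ∀ a b c d → SlopeLt a b c d ⇔ 0ℚ < orient a b d - orient a b c
SlopeLt⇔ a b c d = ⇔.trans <⇔0<- (mk⇔ (subst (0ℚ <_) (slope-difference a b c d))
                                        (subst (0ℚ <_) (sym (slope-difference a b c d))))

-- For crossing segments c and d lie on opposite sides of a → b, so the difference of the two
-- orientations has the sign of orient a b d.
crossing⇒SlopeLt⇔ : ∀ {a b c d} → Cross a b c d → SlopeLt a b c d ⇔ 0ℚ < orient a b d
crossing⇒SlopeLt⇔ {a} {b} {c} {d} (abcd , _)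
  with sign (orient a b c) (*-neg⇒≢0ˡ abcd) | sign (orient a b d) (*-neg⇒≢0ʳ {orient a b c} abcd)
... | s , hc | t , hd with *-neg⇒opposite hc hd abcd
... | refl = ⇔.trans (SlopeLt⇔ a b c d)
                     (mk⇔ (SideOK-transport {t = plus} difference hd) (SideOK-transport {t = plus} hd difference))
  where
  difference : SideOK (opposite s) (orient a b d - orient a b c)
  difference = SideOK-+ hd (SideOK-neg hc)

data OrderType (a b c : ℕ) : Sign → ℕ → Set where
  abc : a ℕ.< b → b ℕ.< c → OrderType a b c plus  b
  bca : b ℕ.< c → c ℕ.< a → OrderType a b c plus  c
  cab : c ℕ.< a → a ℕ.< b → OrderType a b c plus  a
  bac : b ℕ.< a → a ℕ.< c → OrderType a b c minus a
  acb : a ℕ.< c → c ℕ.< b → OrderType a b c minus c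
  cba : c ℕ.< b → b ℕ.< a → OrderType a b c minus b

orderType : ∀ {a b c} → a ≢ b → b ≢ c → a ≢ c → Σ Sign λ s → Σ ℕ λ m → OrderType a b c s m
orderType {a} {b} {c} a≢b b≢c a≢c with ℕₚ.<-cmp a b | ℕₚ.<-cmp b c | ℕₚ.<-cmp a c
... | tri≈ _ a≡b _ | _           | _           = ⊥-elim (a≢b a≡b)
... | _           | tri≈ _ b≡c _ | _           = ⊥-elim (b≢c b≡c)
... | _           | _           | tri≈ _ a≡c _ = ⊥-elim (a≢c a≡c)
... | tri< a<b _ _ | tri< b<c _ _ | _           = plus  , b , abc a<b b<c
... | tri< _ _ _   | tri> _ _ c<b | tri< a<c _ _ = minus , c , acb a<c c<b
... | tri< a<b _ _ | tri> _ _ _   | tri> _ _ c<a = plus  , a , cab c<a a<b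
... | tri> _ _ b<a | tri< _ _ _   | tri< a<c _ _ = minus , a , bac b<a a<c
... | tri> _ _ _   | tri< b<c _ _ | tri> _ _ c<a = plus  , c , bca b<c c<a
... | tri> _ _ b<a | tri> _ _ c<b | _           = minus , b , cba c<b b<a

module ConvexChain (Z : ℕ) (P : ℕ → Point)
  (increasing : XIncreasing (suc Z) P) (convex : ConvexPosition (suc Z) P) where

  o : ℕ → ℕ → ℕ → ℚ
  o i j k = orient (P i) (P j) (P k)

  Δx-pos : ∀ {i j} → i ℕ.< j → j ℕ.< suc Z → 0ℚ < xc (P j) - xc (P i)
  Δx-pos i<j j≤Z = Equivalence.to <⇔0<- (increasing _ _ (ℕₚ.<-trans i<j j≤Z) j≤Z i<j)

  o≢0 : ∀ {x y z} → x ℕ.< y → y ℕ.< z → z ℕ.< suc Z → o x y z ≢ 0ℚ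
  o≢0 {x} {y} {z} x<y y<z z≤Z = proj₁ (proj₂ convex) _ _ _ x≤Z y≤Z z≤Z
    (ℕₚ.<⇒≢ x<y) (ℕₚ.<⇒≢ y<z) (ℕₚ.<⇒≢ (ℕₚ.<-trans x<y y<z))
    where
    y≤Z : y ℕ.< suc Z
    y≤Z = ℕₚ.<-trans y<z z≤Z
    x≤Z : x ℕ.< suc Z
    x≤Z = ℕₚ.<-trans x<y y≤Z

  x∉wyz : ∀ {w x y z} → w ℕ.< x → x ℕ.< y → y ℕ.< z → z ℕ.< suc Z →
    ¬ InTriangle (P w) (P y) (P z) (P x)
  x∉wyz {w} {x} {y} {z} w<x x<y y<z z≤Z = proj₂ (proj₂ convex) _ _ _ _ w≤Z y≤Z z≤Z x≤Z
    (ℕₚ.<⇒≢ w<y) (ℕₚ.<⇒≢ (ℕₚ.<-trans w<y y<z)) (ℕₚ.<⇒≢ w<x)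
    (ℕₚ.<⇒≢ y<z) (ℕₚ.>⇒≢ x<y) (ℕₚ.>⇒≢ (ℕₚ.<-trans x<y y<z))
    where
    w<y : w ℕ.< y
    w<y = ℕₚ.<-trans w<x x<y
    y≤Z : y ℕ.< suc Z
    y≤Z = ℕₚ.<-trans y<z z≤Z
    x≤Z : x ℕ.< suc Z
    x≤Z = ℕₚ.<-trans x<y y≤Z
    w≤Z : w ℕ.< suc Z
    w≤Z = ℕₚ.<-trans w<x x≤Z

  y∉wxz : ∀ {w x y z} → w ℕ.< x → x ℕ.< y → y ℕ.< z → z ℕ.< suc Z →
    ¬ InTriangle (P w) (P x) (P z) (P y)
  y∉wxz {w} {x} {y} {z} w<x x<y y<z z≤Z = proj₂ (proj₂ convex) _ _ _ _ w≤Z x≤Z z≤Z y≤Z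
    (ℕₚ.<⇒≢ w<x) (ℕₚ.<⇒≢ (ℕₚ.<-trans w<x x<z)) (ℕₚ.<⇒≢ (ℕₚ.<-trans w<x x<y))
    (ℕₚ.<⇒≢ x<z) (ℕₚ.<⇒≢ x<y) (ℕₚ.>⇒≢ y<z)
    where
    x<z : x ℕ.< z
    x<z = ℕₚ.<-trans x<y y<z
    y≤Z : y ℕ.< suc Z
    y≤Z = ℕₚ.<-trans y<z z≤Z
    x≤Z : x ℕ.< suc Z
    x≤Z = ℕₚ.<-trans x<y y≤Z
    w≤Z : w ℕ.< suc Z
    w≤Z = ℕₚ.<-trans w<x x≤Z

  SideOK⇒InTriangle : ∀ {s} a b c d → SideOK s (orient a b d) → SideOK s (orient b c d) →
    SideOK s (orient c a d) → InTriangle a b c d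
  SideOK⇒InTriangle {plus}  _ _ _ _ h k l = inj₁ (<⇒≤ h , <⇒≤ k , <⇒≤ l)
  SideOK⇒InTriangle {minus} _ _ _ _ h k l = inj₂ (<⇒≤ h , <⇒≤ k , <⇒≤ l)

  -- If w x y had the opposite sign, orient-relation₁ would give x y z the sign s as well, putting
  -- x inside the triangle w y z; o-shrinkˡ is the mirror argument with orient-relation₂.
  o-shrinkʳ : ∀ {s w x y z} → w ℕ.< x → x ℕ.< y → y ℕ.< z → z ℕ.< suc Z →
    SideOK s (o w x z) → SideOK s (o w x y)
  o-shrinkʳ {s} {w} {x} {y} {z} w<x x<y y<z z≤Z wxz with SideOK-dichotomy s (o≢0 w<x x<y y≤Z)
    where
    y≤Z : y ℕ.< suc Z
    y≤Z = ℕₚ.<-trans y<z z≤Z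
  ... | inj₁ wxy = wxy
  ... | inj₂ wxy = ⊥-elim (x∉wyz w<x x<y y<z z≤Z (SideOK⇒InTriangle (P w) (P y) (P z) (P x) wyx yzx zwx))
    where
    y≤Z : y ℕ.< suc Z
    y≤Z = ℕₚ.<-trans y<z z≤Z
    x≤Z : x ℕ.< suc Z
    x≤Z = ℕₚ.<-trans x<y y≤Z
    xyz : SideOK s (o x y z)
    xyz = SideOK-cancel-pos
      (subst (SideOK s) (sym (orient-relation₁ (P w) (P x) (P y) (P z)))
        (SideOK-- (SideOK-*-pos wxz (Δx-pos x<y y≤Z)) (SideOK-*-pos wxy (Δx-pos (ℕₚ.<-trans x<y y<z) z≤Z))))
      (Δx-pos w<x x≤Z)
    wyx : SideOK s (orient (P w) (P y) (P x))
    wyx = subst (SideOK s) (sym (orient-swap (P w) (P y) (P x))) (SideOK-neg′ wxy)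
    yzx : SideOK s (orient (P y) (P z) (P x))
    yzx = subst (SideOK s) (orient-cycle (P x) (P y) (P z)) xyz
    zwx : SideOK s (orient (P z) (P w) (P x))
    zwx = subst (SideOK s) (trans (orient-cycle (P w) (P x) (P z)) (orient-cycle (P x) (P z) (P w))) wxz

  o-shrinkˡ : ∀ {s w x y z} → w ℕ.< x → x ℕ.< y → y ℕ.< z → z ℕ.< suc Z →
    SideOK s (o w y z) → SideOK s (o x y z)
  o-shrinkˡ {s} {w} {x} {y} {z} w<x x<y y<z z≤Z wyz with SideOK-dichotomy s (o≢0 x<y y<z z≤Z)
  ... | inj₁ xyz = xyz
  ... | inj₂ xyz = ⊥-elim (y∉wxz w<x x<y y<z z≤Z (SideOK⇒InTriangle (P w) (P x) (P z) (P y) wxy xzy zwy))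
    where
    y≤Z : y ℕ.< suc Z
    y≤Z = ℕₚ.<-trans y<z z≤Z
    x≤Z : x ℕ.< suc Z
    x≤Z = ℕₚ.<-trans x<y y≤Z
    wxy : SideOK s (orient (P w) (P x) (P y))
    wxy = SideOK-cancel-pos
      (subst (SideOK s) (sym (orient-relation₂ (P w) (P x) (P y) (P z)))
        (SideOK-- (SideOK-*-pos wyz (Δx-pos x<y y≤Z)) (SideOK-*-pos xyz (Δx-pos (ℕₚ.<-trans w<x x<y) y≤Z))))
      (Δx-pos y<z z≤Z)
    xzy : SideOK s (orient (P x) (P z) (P y))
    xzy = subst (SideOK s) (sym (orient-swap (P x) (P z) (P y))) (SideOK-neg′ xyz)
    zwy : SideOK s (orient (P z) (P w) (P y))
    zwy = subst (SideOK s) (trans (orient-cycle (P w) (P y) (P z)) (orient-cycle (P y) (P z) (P w))) wyz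

  IsSideLabelling : (ℕ → Sign) → Set
  IsSideLabelling side = ∀ b → 0 ℕ.< b → b ℕ.< Z → SideOK (side b) (o 0 b Z)

  module _ {side : ℕ → Sign} (labelling : IsSideLabelling side) where

    o-sorted-to-last : ∀ {a b} → a ℕ.< b → b ℕ.< Z → SideOK (side b) (o a b Z)
    o-sorted-to-last {zero}  {b} a<b b<Z = labelling b a<b b<Z
    o-sorted-to-last {suc _} {b} a<b b<Z =
      o-shrinkˡ ℕ.z<s a<b b<Z ℕₚ.≤-refl (labelling b (ℕₚ.<-trans ℕ.z<s a<b) b<Z)

    o-sorted : ∀ {a b c} → a ℕ.< b → b ℕ.< c → c ℕ.< suc Z → SideOK (side b) (o a b c)
    o-sorted a<b b<c c≤Z with ℕₚ.m≤n⇒m<n∨m≡n (ℕₚ.≤-pred c≤Z)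
    ... | inj₁ c<Z  = o-shrinkʳ a<b b<c c<Z ℕₚ.≤-refl (o-sorted-to-last a<b (ℕₚ.<-trans b<c c<Z))
    ... | inj₂ refl = o-sorted-to-last a<b b<c

    o-orderType : ∀ {a b c s m} → OrderType a b c s m → a ℕ.< suc Z → b ℕ.< suc Z → c ℕ.< suc Z →
      SideOK (s · side m) (o a b c)
    o-orderType {a} {b} {c} (abc a<b b<c) _ _ c≤Z = o-sorted a<b b<c c≤Z
    o-orderType {a} {b} {c} (bca b<c c<a) a≤Z _ _ =
      subst (SideOK _) (sym (orient-cycle (P a) (P b) (P c))) (o-sorted b<c c<a a≤Z)
    o-orderType {a} {b} {c} (cab c<a a<b) _ b≤Z _ =
      subst (SideOK _) (sym (trans (orient-cycle (P a) (P b) (P c)) (orient-cycle (P b) (P c) (P a))))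
        (o-sorted c<a a<b b≤Z)
    o-orderType {a} {b} {c} (bac b<a a<c) _ _ c≤Z =
      subst (SideOK _) (trans (cong -_ (orient-cycle (P b) (P a) (P c))) (sym (orient-swap (P a) (P b) (P c))))
        (SideOK-neg (o-sorted b<a a<c c≤Z))
    o-orderType {a} {b} {c} (acb a<c c<b) _ b≤Z _ =
      subst (SideOK _) (sym (orient-swap (P a) (P b) (P c))) (SideOK-neg (o-sorted a<c c<b b≤Z))
    o-orderType {a} {b} {c} (cba c<b b<a) a≤Z _ _ =
      subst (SideOK _)
        (trans (cong -_ (trans (orient-cycle (P c) (P b) (P a)) (orient-cycle (P b) (P a) (P c))))
               (sym (orient-swap (P a) (P b) (P c))))
        (SideOK-neg (o-sorted c<b b<a a≤Z))

data Colour : Set where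
  ● ○ : Colour

vertex : Colour → ℕ → ℕ
vertex ● i = 2 ℕ.* i
vertex ○ j = 2 ℕ.* j ∸ 1

vertex-suc-suc : ∀ c k → vertex c (suc (suc k)) ≡ suc (suc (vertex c (suc k)))
vertex-suc-suc ● k = ℕₚ.*-suc 2 (suc k)
vertex-suc-suc ○ k = begin
  2 ℕ.* suc (suc k) ∸ 1         ≡⟨ cong (_∸ 1) (ℕₚ.*-suc 2 (suc k)) ⟩
  suc (2 ℕ.* suc k)             ≡⟨ cong suc (ℕₚ.*-suc 2 k) ⟩
  suc (suc (suc (2 ℕ.* k)))     ≡⟨ cong (λ x → suc (suc (x ∸ 1))) (ℕₚ.*-suc 2 k) ⟨
  suc (suc (2 ℕ.* suc k ∸ 1))   ∎
  where open ≡-Reasoning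

vertex≤2* : ∀ c a → vertex c a ℕ.≤ 2 ℕ.* a
vertex≤2* ● a = ℕₚ.≤-refl
vertex≤2* ○ a = ℕₚ.m∸n≤m (2 ℕ.* a) 1

2*<vertex-suc : ∀ c b → 2 ℕ.* b ℕ.< vertex c (suc b)
2*<vertex-suc ● b = subst (2 ℕ.* b ℕ.<_) (sym (ℕₚ.*-suc 2 b)) (ℕₚ.n≤1+n _)
2*<vertex-suc ○ b = subst (λ x → 2 ℕ.* b ℕ.< x ∸ 1) (sym (ℕₚ.*-suc 2 b)) (ℕₚ.n<1+n _)

vertex-mono : ∀ c c′ {a b} → a ℕ.< b → vertex c a ℕ.< vertex c′ b
vertex-mono c c′ {a} {suc b} (s≤s a≤b) =
  ℕₚ.≤-<-trans (ℕₚ.≤-trans (vertex≤2* c a) (ℕₚ.*-monoʳ-≤ 2 a≤b)) (2*<vertex-suc c′ b)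

vertex○<vertex● : ∀ {j} → 0 ℕ.< j → vertex ○ j ℕ.< vertex ● j
vertex○<vertex● {suc j} _ = subst (λ x → x ∸ 1 ℕ.< x) (sym (ℕₚ.*-suc 2 j)) (ℕₚ.n<1+n _)

⌈vertex/2⌉ : ∀ c a → ⌈ vertex c a /2⌉ ≡ a
⌈vertex/2⌉ ● a rewrite ℕₚ.+-identityʳ a = sym (ℕₚ.n≡⌈n+n/2⌉ a)
⌈vertex/2⌉ ○ zero = refl
⌈vertex/2⌉ ○ (suc a) rewrite ℕₚ.+-identityʳ a | ℕₚ.+-suc a a = cong suc (sym (ℕₚ.n≡⌊n+n/2⌋ a))

vertex-cover : ∀ v → 0 ℕ.< v → Σ Colour λ c → Σ ℕ λ k → v ≡ vertex c (suc k)
vertex-cover (suc zero)          _ = ○ , 0 , refl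
vertex-cover (suc (suc zero))    _ = ● , 0 , refl
vertex-cover (suc (suc (suc v))) _ with vertex-cover (suc v) ℕ.z<s
... | c , k , v≡ = c , suc k , trans (cong (λ x → suc (suc x)) v≡) (sym (vertex-suc-suc c k))

vertex<⇒< : ∀ c {x} n → vertex c x ℕ.< suc (suc (2 ℕ.* n)) → x ℕ.< suc (suc n)
vertex<⇒< c {zero}  n _ = ℕ.z<s
vertex<⇒< c {suc x} n v< = s≤s (ℕₚ.*-cancelˡ-< 2 x (suc n)
  (subst (2 ℕ.* x ℕ.<_) (sym (ℕₚ.*-suc 2 n)) (ℕₚ.<-trans (2*<vertex-suc c x) v<)))

vertex●< : ∀ {i n} → i ℕ.< suc n → vertex ● i ℕ.< suc (suc (2 ℕ.* n))
vertex●< i≤n = s≤s (ℕₚ.m≤n⇒m≤1+n (ℕₚ.*-monoʳ-≤ 2 (ℕₚ.≤-pred i≤n)))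

vertex○< : ∀ {j n} → j ℕ.≤ suc n → vertex ○ j ℕ.< suc (suc (2 ℕ.* n))
vertex○< {j} {n} j≤n+1 =
  s≤s (subst (vertex ○ j ℕ.≤_) (cong (_∸ 1) (ℕₚ.*-suc 2 n)) (ℕₚ.∸-monoˡ-≤ 1 (ℕₚ.*-monoʳ-≤ 2 j≤n+1)))

OrderType-vertex : ∀ ca cb cc {a b c s m} → OrderType a b c s m →
  Σ ℕ λ m′ → OrderType (vertex ca a) (vertex cb b) (vertex cc c) s m′ × ⌈ m′ /2⌉ ≡ m
OrderType-vertex ca cb cc {a} {b} {c} (abc a<b b<c) =
  vertex cb b , abc (vertex-mono ca cb a<b) (vertex-mono cb cc b<c) , ⌈vertex/2⌉ cb b
OrderType-vertex ca cb cc {a} {b} {c} (bca b<c c<a) =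
  vertex cc c , bca (vertex-mono cb cc b<c) (vertex-mono cc ca c<a) , ⌈vertex/2⌉ cc c
OrderType-vertex ca cb cc {a} {b} {c} (cab c<a a<b) =
  vertex ca a , cab (vertex-mono cc ca c<a) (vertex-mono ca cb a<b) , ⌈vertex/2⌉ ca a
OrderType-vertex ca cb cc {a} {b} {c} (bac b<a a<c) =
  vertex ca a , bac (vertex-mono cb ca b<a) (vertex-mono ca cc a<c) , ⌈vertex/2⌉ ca a
OrderType-vertex ca cb cc {a} {b} {c} (acb a<c c<b) =
  vertex cc c , acb (vertex-mono ca cc a<c) (vertex-mono cc cb c<b) , ⌈vertex/2⌉ cc c
OrderType-vertex ca cb cc {a} {b} {c} (cba c<b b<a) =
  vertex cb b , cba (vertex-mono cc cb c<b) (vertex-mono cb ca b<a) , ⌈vertex/2⌉ cb b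

≡ᵇ-refl : ∀ c → (c ℕ.≡ᵇ c) ≡ true
≡ᵇ-refl c = Equivalence.to T-≡ (ℕₚ.≡⇒≡ᵇ c c refl)

≡ᵇ⇒≡ : ∀ {i c} → (i ℕ.≡ᵇ c) ≡ true → i ≡ c
≡ᵇ⇒≡ {i} {c} e = ℕₚ.≡ᵇ⇒≡ i c (Equivalence.from T-≡ e)

remove-self : ∀ S a b → remove S a b a b ≡ false
remove-self S a b rewrite ≡ᵇ-refl a | ≡ᵇ-refl b = ∧-zeroʳ (S a b)

remove-keeps : ∀ S a b {i j} → S i j ≡ true → ¬ (i ≡ a × j ≡ b) → remove S a b i j ≡ true
remove-keeps S a b {i} {j} ij∈S ij≢ab with S i j | i ℕ.≡ᵇ a in i≡a | j ℕ.≡ᵇ b in j≡b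
... | true | true  | true  = ⊥-elim (ij≢ab (≡ᵇ⇒≡ i≡a , ≡ᵇ⇒≡ j≡b))
... | true | true  | false = refl
... | true | false | _     = refl

remove-⊆ : ∀ S a b → remove S a b ⊆ S
remove-⊆ S a b i j _ with S i j
... | true = refl

insert : EdgeSet → ℕ → ℕ → EdgeSet
insert S c d i j = S i j ∨ ((i ℕ.≡ᵇ c) ∧ (j ℕ.≡ᵇ d))

insert-⊇ : ∀ S c d → S ⊆ insert S c d
insert-⊇ S c d i j ij∈S rewrite ij∈S = refl

insert-new : ∀ S c d → insert S c d c d ≡ true
insert-new S c d rewrite ≡ᵇ-refl c | ≡ᵇ-refl d = ∨-zeroʳ (S c d)

insert-cases : ∀ S c d {i j} → insert S c d i j ≡ true → S i j ≡ true ⊎ (i ≡ c × j ≡ d)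
insert-cases S c d {i} {j} ij∈ with S i j | i ℕ.≡ᵇ c in i≡c | j ℕ.≡ᵇ d in j≡d
... | true  | _    | _    = inj₁ refl
... | false | true | true = inj₂ (≡ᵇ⇒≡ i≡c , ≡ᵇ⇒≡ j≡d)

IsSegment : ℕ → ℕ → ℕ → Set
IsSegment n i j = i ℕ.< j × j ℕ.≤ suc n

insert-wellFormed : ∀ {n S c d} → WellFormed n S → IsSegment n c d → WellFormed n (insert S c d)
insert-wellFormed {S = S} {c} {d} wf cd i j ij∈ with insert-cases S c d ij∈
... | inj₁ ij∈S        = wf i j ij∈S
... | inj₂ (refl , refl) = cd

insert-nonCrossing : ∀ {L R : ℕ → Point} {S c d} → NonCrossing L R S →
  (∀ i j → S i j ≡ true → ¬ Cross (L i) (R j) (L c) (R d)) → NonCrossing L R (insert S c d)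
insert-nonCrossing {L} {R} {S} {c} {d} nc new i j k l ij∈ kl∈
  with insert-cases S c d ij∈ | insert-cases S c d kl∈
... | inj₁ ij∈S          | inj₁ kl∈S          = nc i j k l ij∈S kl∈S
... | inj₁ ij∈S          | inj₂ (refl , refl) = new i j ij∈S
... | inj₂ (refl , refl) | inj₁ kl∈S          = λ cr → new k l kl∈S (Cross-sym {L c} {R d} {L k} {R l} cr)
... | inj₂ (refl , refl) | inj₂ (refl , refl) = λ cr → proj₁ (Cross⇒distinct {L c} {R d} {L c} {R d} cr) refl

Cross? : ∀ a b c d → Dec (Cross a b c d)
Cross? a b c d with (orient a b c * orient a b d) <? 0ℚ | (orient c d a * orient c d b) <? 0ℚ
... | yes abcd | yes cdab = yes (abcd , cdab)
... | no ¬abcd | _        = no (λ cr → ¬abcd (proj₁ cr))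
... | yes _    | no ¬cdab = no (λ cr → ¬cdab (proj₂ cr))

-- Were δ' = (c , d) not crossing δ = (a , b), then S ∪ {δ'} would be non-crossing, so δ' ∈ S by
-- maximality; but δ' ∉ S' ∖ {δ'} = S ∖ {δ} ∋ δ'.
flip-diagonals-cross : ∀ {n L R S S′ a b c d} → MaxNonCrossing n L R S → MaxNonCrossing n L R S′ →
  S a b ≡ true → S′ c d ≡ true → ¬ (a ≡ c × b ≡ d) →
  (∀ i j → remove S a b i j ≡ remove S′ c d i j) → Cross (L a) (R b) (L c) (R d)
flip-diagonals-cross {n} {L} {R} {S} {S′} {a} {b} {c} {d}
  (wf , nc , max) (wf′ , nc′ , _) ab∈S cd∈S′ ab≢cd same-rest with Cross? (L a) (R b) (L c) (R d)
... | yes cr = cr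
... | no ¬cr = ⊥-elim (false≢true (begin
    false               ≡⟨ remove-self S′ c d ⟨
    remove S′ c d c d   ≡⟨ same-rest c d ⟨
    remove S a b c d    ≡⟨ remove-keeps S a b cd∈S (λ { (refl , refl) → ab≢cd (refl , refl) }) ⟩
    true                ∎))
  where
  open ≡-Reasoning
  false≢true : false ≢ true
  false≢true ()
  misses-cd : ∀ i j → S i j ≡ true → ¬ Cross (L i) (R j) (L c) (R d)
  misses-cd i j ij∈S with i ℕ.≟ a | j ℕ.≟ b
  ... | yes refl | yes refl = ¬cr
  ... | yes refl | no j≢b   = nc′ i j c d (remove-⊆ S′ c d i j (trans (sym (same-rest i j))
                                 (remove-keeps S a b ij∈S (λ e → j≢b (proj₂ e))))) cd∈S′
  ... | no i≢a   | _        = nc′ i j c d (remove-⊆ S′ c d i j (trans (sym (same-rest i j))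
                                 (remove-keeps S a b ij∈S (λ e → i≢a (proj₁ e))))) cd∈S′
  cd∈S : S c d ≡ true
  cd∈S = max (insert S c d) (insert-wellFormed wf (wf′ c d cd∈S′)) (insert-nonCrossing {L} {R} nc misses-cd)
             (insert-⊇ S c d) c d (insert-new S c d)

record SameCrossings (n : ℕ) (L R L′ R′ : ℕ → Point) : Set where
  constructor sameCrossings
  field
    cross⇔ : ∀ {i j k l} → IsSegment n i j → IsSegment n k l →
      Cross (L i) (R j) (L k) (R l) ⇔ Cross (L′ i) (R′ j) (L′ k) (R′ l)

record SameSlopeOrder (n : ℕ) (L R L′ R′ : ℕ → Point) : Set where
  constructor sameSlopeOrder
  field
    slopeLt⇔ : ∀ {i j k l} → IsSegment n i j → IsSegment n k l → Cross (L i) (R j) (L k) (R l) →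
      SlopeLt (L i) (R j) (L k) (R l) ⇔ SlopeLt (L′ i) (R′ j) (L′ k) (R′ l)

open SameCrossings
open SameSlopeOrder

module _ {n : ℕ} {L R L′ R′ : ℕ → Point} (same : SameCrossings n L R L′ R′) where

  SameCrossings-sym : SameCrossings n L′ R′ L R
  SameCrossings-sym = sameCrossings λ ij kl → ⇔.sym (cross⇔ same ij kl)

  SameSlopeOrder-sym : SameSlopeOrder n L R L′ R′ → SameSlopeOrder n L′ R′ L R
  SameSlopeOrder-sym slopes =
    sameSlopeOrder λ ij kl cr → ⇔.sym (slopeLt⇔ slopes ij kl (Equivalence.from (cross⇔ same ij kl) cr))

  nonCrossing-reflect : ∀ {S} → WellFormed n S → NonCrossing L′ R′ S → NonCrossing L R S
  nonCrossing-reflect wf nc i j k l ij∈ kl∈ cr =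
    nc i j k l ij∈ kl∈ (Equivalence.to (cross⇔ same (wf i j ij∈) (wf k l kl∈)) cr)

module _ {n : ℕ} {L R L′ R′ : ℕ → Point} (same : SameCrossings n L R L′ R′) where

  maxNonCrossing-transfer : ∀ {S} → MaxNonCrossing n L R S → MaxNonCrossing n L′ R′ S
  maxNonCrossing-transfer (wf , nc , max) =
    wf , nonCrossing-reflect (SameCrossings-sym same) wf nc ,
    λ S′ wf′ nc′ → max S′ wf′ (nonCrossing-reflect same wf′ nc′)

  incFlip-transfer : SameSlopeOrder n L R L′ R′ → ∀ {S S′} → IncFlip n L R S S′ → IncFlip n L′ R′ S S′
  incFlip-transfer slopes (max , max′ , a , b , c , d , ab∈S , cd∈S′ , ab≢cd , same-rest , lt) =
    maxNonCrossing-transfer max , maxNonCrossing-transfer max′ ,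
    a , b , c , d , ab∈S , cd∈S′ , ab≢cd , same-rest ,
    Equivalence.to (slopeLt⇔ slopes (proj₁ max a b ab∈S) (proj₁ max′ c d cd∈S′)
                           (flip-diagonals-cross {L = L} {R} max max′ ab∈S cd∈S′ ab≢cd same-rest)) lt

module Correspondence (n : ℕ) (ε : Fin n → Sign) (p q : ℕ → Point)
  (square : IsSquarePolygon n ε p) (blackWhite : IsBlackWhitePolygon n ε q) where

  module Sq = ConvexChain (suc n) p (proj₁ square) (proj₁ (proj₂ square))
  module BW = ConvexChain (suc (2 ℕ.* n)) q (proj₁ blackWhite) (proj₁ (proj₂ blackWhite))

  -- Only the values at 1 … n matter.
  side : ℕ → Sign
  side zero = plus
  side (suc k) with k ℕ.<? n
  ... | yes k<n = opposite (ε (fromℕ< k<n))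
  ... | no _    = plus

  side-suc : ∀ {k} (k<n : k ℕ.< n) → side (suc k) ≡ opposite (ε (fromℕ< k<n))
  side-suc {k} k<n with k ℕ.<? n
  ... | yes k<n′ = cong (λ h → opposite (ε (fromℕ< h))) (ℕₚ.<-irrelevant k<n′ k<n)
  ... | no k≮n   = ⊥-elim (k≮n k<n)

  square-sides : Sq.IsSideLabelling side
  square-sides (suc k) _ (s≤s k<n) =
    subst (λ s → SideOK s (Sq.o 0 (suc k) (suc n))) (sym (side-suc k<n))
      (subst (SideOK _) (sym (orient-swap (p 0) (p (suc k)) (p (suc n))))
        (SideOK-neg (proj₂ (proj₂ square) k k<n)))

  blackWhite-side : ∀ c {k} (k<n : k ℕ.< n) →
    SideOK (ε (fromℕ< k<n)) (orient (q 0) (white q (suc n)) (q (vertex c (suc k))))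
  blackWhite-side ● k<n = proj₂ (proj₂ (proj₂ blackWhite) _ k<n)
  blackWhite-side ○ k<n = proj₁ (proj₂ (proj₂ blackWhite) _ k<n)

  blackWhite-sides : BW.IsSideLabelling (λ v → side ⌈ v /2⌉)
  blackWhite-sides v 0<v v<Z with vertex-cover v 0<v
  ... | c , k , refl =
    subst (λ s → SideOK s (BW.o 0 v (suc (2 ℕ.* n))))
      (sym (trans (cong side (⌈vertex/2⌉ c (suc k))) (side-suc k<n)))
      (subst (SideOK _) (sym (orient-swap (q 0) (q v) (q (suc (2 ℕ.* n)))))
        (SideOK-neg (subst (λ w → SideOK (ε (fromℕ< k<n)) (orient (q 0) w (q v))) white-last (blackWhite-side c k<n))))
    where
    k<n : k ℕ.< n
    k<n = ℕₚ.*-cancelˡ-< 2 k n (ℕₚ.≤-pred (ℕₚ.≤-<-trans (2*<vertex-suc c k) v<Z))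
    white-last : white q (suc n) ≡ q (suc (2 ℕ.* n))
    white-last = cong (λ w → q (w ∸ 1)) (ℕₚ.*-suc 2 n)

  o-agrees : ∀ cx cy cz {x y z} → x ≢ y → y ≢ z → x ≢ z →
    vertex cx x ℕ.< suc (suc (2 ℕ.* n)) → vertex cy y ℕ.< suc (suc (2 ℕ.* n)) →
    vertex cz z ℕ.< suc (suc (2 ℕ.* n)) →
    SameSign (Sq.o x y z) (BW.o (vertex cx x) (vertex cy y) (vertex cz z))
  o-agrees cx cy cz x≢y y≢z x≢z vx vy vz with orderType x≢y y≢z x≢z
  ... | s , m , xyz with OrderType-vertex cx cy cz xyz
  ... | m′ , xyz′ , ⌈m′/2⌉≡m =
    s · side m ,
    Sq.o-orderType square-sides xyz (vertex<⇒< cx n vx) (vertex<⇒< cy n vy) (vertex<⇒< cz n vz) ,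
    subst (λ w → SideOK (s · side w) _) ⌈m′/2⌉≡m (BW.o-orderType blackWhite-sides xyz′ vx vy vz)

  -- j∘ immediately precedes j• in x-order, so j• and l∘ lie on the same side of i• → j∘, namely
  -- the side of j∘.
  blackWhite-shared-endpoint : ∀ {i j l} → i ℕ.< j → j ℕ.< l → l ℕ.≤ suc n →
    ¬ Cross (black q i) (white q j) (black q j) (white q l)
  blackWhite-shared-endpoint i<j j<l l≤n+1 (ijjl , _) = same-side⇒¬*-neg
    (BW.o-sorted blackWhite-sides (vertex-mono ● ○ i<j) (vertex○<vertex● (ℕₚ.≤-<-trans z≤n i<j))
                 (vertex●< (ℕₚ.<-≤-trans j<l l≤n+1)))
    (BW.o-sorted blackWhite-sides (vertex-mono ● ○ i<j) (vertex-mono ○ ○ j<l) (vertex○< l≤n+1))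
    ijjl

  square-cross⇒distinct : ∀ {i j k l} → Cross (p i) (p j) (p k) (p l) → i ≢ k × j ≢ l × j ≢ k × i ≢ l
  square-cross⇒distinct {i} {j} {k} {l} cr with Cross⇒distinct {p i} {p j} {p k} {p l} cr
  ... | pi≢pk , pj≢pl , pj≢pk , pi≢pl =
    (λ e → pi≢pk (cong p e)) , (λ e → pj≢pl (cong p e)) , (λ e → pj≢pk (cong p e)) , (λ e → pi≢pl (cong p e))

  blackWhite-cross⇒distinct : ∀ {i j k l} → IsSegment n i j → IsSegment n k l →
    Cross (black q i) (white q j) (black q k) (white q l) → i ≢ k × j ≢ l × j ≢ k × i ≢ l
  blackWhite-cross⇒distinct {i} {j} {k} {l} (i<j , j≤n+1) (k<l , l≤n+1) cr
    with Cross⇒distinct {black q i} {white q j} {black q k} {white q l} cr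
  ... | bi≢bk , wj≢wl , _ , _ =
    (λ e → bi≢bk (cong (black q) e)) , (λ e → wj≢wl (cong (white q) e)) ,
    (λ { refl → blackWhite-shared-endpoint i<j k<l l≤n+1 cr }) ,
    (λ { refl → blackWhite-shared-endpoint k<l i<j j≤n+1
                  (Cross-sym {black q i} {white q j} {black q k} {white q l} cr) })

  segment-orientations-agree : ∀ {i j k l} → IsSegment n i j → IsSegment n k l →
    i ≢ k → j ≢ l → j ≢ k → i ≢ l →
    SameSign (orient (p i) (p j) (p k)) (orient (black q i) (white q j) (black q k))
    × SameSign (orient (p i) (p j) (p l)) (orient (black q i) (white q j) (white q l))
    × SameSign (orient (p k) (p l) (p i)) (orient (black q k) (white q l) (black q i))
    × SameSign (orient (p k) (p l) (p j)) (orient (black q k) (white q l) (white q j))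
  segment-orientations-agree {i} {j} {k} {l} (i<j , j≤n+1) (k<l , l≤n+1) i≢k j≢l j≢k i≢l =
    o-agrees ● ○ ● i≢j j≢k i≢k vi vj vk ,
    o-agrees ● ○ ○ i≢j j≢l i≢l vi vj vl ,
    o-agrees ● ○ ● k≢l (≢-sym i≢l) (≢-sym i≢k) vk vl vi ,
    o-agrees ● ○ ○ k≢l (≢-sym j≢l) (≢-sym j≢k) vk vl vj
    where
    i≢j : i ≢ j
    i≢j = ℕₚ.<⇒≢ i<j
    k≢l : k ≢ l
    k≢l = ℕₚ.<⇒≢ k<l
    vi : vertex ● i ℕ.< suc (suc (2 ℕ.* n))
    vi = vertex●< (ℕₚ.<-≤-trans i<j j≤n+1)
    vk : vertex ● k ℕ.< suc (suc (2 ℕ.* n))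
    vk = vertex●< (ℕₚ.<-≤-trans k<l l≤n+1)
    vj : vertex ○ j ℕ.< suc (suc (2 ℕ.* n))
    vj = vertex○< j≤n+1
    vl : vertex ○ l ℕ.< suc (suc (2 ℕ.* n))
    vl = vertex○< l≤n+1

  crossings-agree : SameCrossings n p p (black q) (white q)
  crossings-agree = sameCrossings λ ij kl → mk⇔ (Sq⇒BW ij kl) (BW⇒Sq ij kl)
    where
    Sq⇒BW : ∀ {i j k l} → IsSegment n i j → IsSegment n k l →
      Cross (p i) (p j) (p k) (p l) → Cross (black q i) (white q j) (black q k) (white q l)
    Sq⇒BW {i} {j} {k} {l} ij kl cr with square-cross⇒distinct cr
    ... | i≢k , j≢l , j≢k , i≢l with segment-orientations-agree ij kl i≢k j≢l j≢k i≢l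
    ... | ijk , ijl , kli , klj =
      Cross-transfer {p i} {p j} {p k} {p l} {black q i} {white q j} {black q k} {white q l} ijk ijl kli klj cr
    BW⇒Sq : ∀ {i j k l} → IsSegment n i j → IsSegment n k l →
      Cross (black q i) (white q j) (black q k) (white q l) → Cross (p i) (p j) (p k) (p l)
    BW⇒Sq {i} {j} {k} {l} ij kl cr with blackWhite-cross⇒distinct ij kl cr
    ... | i≢k , j≢l , j≢k , i≢l with segment-orientations-agree ij kl i≢k j≢l j≢k i≢l
    ... | ijk , ijl , kli , klj =
      Cross-transfer {black q i} {white q j} {black q k} {white q l} {p i} {p j} {p k} {p l}
        (SameSign-sym ijk) (SameSign-sym ijl) (SameSign-sym kli) (SameSign-sym klj) cr

  slopes-agree : SameSlopeOrder n p p (black q) (white q)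
  slopes-agree = sameSlopeOrder agree
    where
    agree : ∀ {i j k l} → IsSegment n i j → IsSegment n k l → Cross (p i) (p j) (p k) (p l) →
      SlopeLt (p i) (p j) (p k) (p l) ⇔ SlopeLt (black q i) (white q j) (black q k) (white q l)
    agree {i} {j} {k} {l} ij kl cr with square-cross⇒distinct cr
    ... | i≢k , j≢l , j≢k , i≢l with segment-orientations-agree ij kl i≢k j≢l j≢k i≢l
    ... | _ , ijl , _ , _ =
      ⇔.trans (crossing⇒SlopeLt⇔ {p i} {p j} {p k} {p l} cr)
        (⇔.trans (SameSign-pos⇔ ijl)
          (⇔.sym (crossing⇒SlopeLt⇔ {black q i} {white q j} {black q k} {white q l}
                    (Equivalence.to (cross⇔ crossings-agree ij kl) cr))))

lemma2p7 : (n : ℕ) → n ≥ 1 → (ε : Fin n → Sign)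
    → (p q : ℕ → Point) → IsSquarePolygon n ε p → IsBlackWhitePolygon n ε q
    → (∀ T → IsTriangulation n p T ⇔ IsEpsTree n q (φ T))
      × (∀ T T' → IsTriangulation n p T → IsTriangulation n p T'
           → IncFlipTri n p T T' ⇔ IncFlipTree n q (φ T) (φ T'))
      × (∀ T T' → IsTriangulation n p T → IsTriangulation n p T'
           → CambrianLe n p T T' ⇔ TreeLe n q (φ T) (φ T'))
-- The argument does not need n ≥ 1.
lemma2p7 n _ ε p q square blackWhite =
  (λ _ → mk⇔ (maxNonCrossing-transfer crossings-agree) (maxNonCrossing-transfer crossings-agree⁻¹)) ,
  (λ _ _ _ _ → mk⇔ flip⇒ flip⇐) ,
  (λ _ _ _ _ → mk⇔ (Star.map flip⇒) (Star.map flip⇐))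
  where
  open Correspondence n ε p q square blackWhite
  crossings-agree⁻¹ : SameCrossings n (black q) (white q) p p
  crossings-agree⁻¹ = SameCrossings-sym crossings-agree
  flip⇒ : ∀ {T T′} → IncFlipTri n p T T′ → IncFlipTree n q T T′
  flip⇒ = incFlip-transfer crossings-agree slopes-agree
  flip⇐ : ∀ {T T′} → IncFlipTree n q T T′ → IncFlipTri n p T T′
  flip⇐ = incFlip-transfer crossings-agree⁻¹ (SameSlopeOrder-sym crossings-agree slopes-agree)
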